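{- Let $r_1,r_2\in\mathbb{Z}$ and let $(U_n)_{n\ge0}$ be a sequence of integers with $U_n=r_1U_{n-1}+r_2U_{n-2}$ for all $n\ge2$. Let $\alpha,\beta$ be the roots of $x^2-r_1x-r_2$, assume $\alpha\neq\beta$, and assume $\Delta=(\alpha-\beta)^2=r_1^2+4r_2$ is the square of an integer. Then the sequence $(r_2\operatorname{rad}(\Delta)U_n)_{n\ge1}$ satisfies the Dold condition.
   Context: A sequence of integers $(A_n)_{n\ge1}$ satisfies the Dold condition if $n\mid\sum_{d\mid n}\mu(d)A_{n/d}$ for every $n\in\mathbb{N}_+$ ($\mu$ the Möbius function). For a nonzero integer $m$, $\operatorname{rad}(m)$ denotes the product of the distinct primes dividing $m$. -}

module Defs where

open import Data.Nat as ℕ using (ℕ; zero; suc; NonZero)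
open import Data.Nat.Divisibility using (_∣?_)
open import Data.Nat.Primality using (prime?)
open import Data.Nat.DivMod using (_/_)
open import Data.List using (List; []; _∷_; filter; upTo; map; length; foldr)
open import Data.Nat.ListAction using (product)
open import Data.Integer.Divisibility using () renaming (_∣_ to _∣ℤ_)
open import Data.Integer as ℤ using (ℤ; +_; -[1+_]; 0ℤ; 1ℤ)
open import Relation.Nullary using (yes; no; ¬_)
open import Relation.Nullary.Decidable using (_×-dec_; ⌊_⌋)
open import Data.Bool using (Bool; true; false; if_then_else_)

divisors : ℕ → List ℕ
divisors n = filter (λ d → d ∣? n) (map suc (upTo n))

primeDivisors : ℕ → List ℕ
primeDivisors n = filter (λ p → prime? p ×-dec (p ∣? n)) (divisors n)

radℕ : ℕ → ℕ
radℕ m = product (primeDivisors m)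

rad : ℤ → ℕ
rad m = radℕ ℤ.∣ m ∣

squarefree : ℕ → Bool
squarefree n = foldr (λ p b → if ⌊ (p ℕ.* p) ∣? n ⌋ then false else b) true (primeDivisors n)

μ : ℕ → ℤ
μ n = if squarefree n then (ℤ.- 1ℤ) ℤ.^ length (primeDivisors n) else 0ℤ

doldSum : (ℕ → ℤ) → ℕ → ℤ
doldSum A n = foldr (λ d s → μ d ℤ.* A (quot n d) ℤ.+ s) 0ℤ (divisors n)
  where
  quot : ℕ → ℕ → ℕ
  quot n zero = 0
  quot n (suc d) = n / suc d

-- Dold condition for a sequence (A_n)_{n ≥ 1} (the value A 0 is irrelevant)
Dold : (ℕ → ℤ) → Set
Dold A = ∀ (n : ℕ) → .{{_ : NonZero n}} → (+ n) ∣ℤ doldSum A n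

{-# OPTIONS --safe #-}
-- The discriminant Δ = (α − β)² is a square, so the roots α, β of x² − r₁x − r₂ are integers and
-- Uₙ = c·Gₙ + U₀·βⁿ with c = U₁ − βU₀ and Gₙ = (αⁿ − βⁿ)/(α − β).
--
-- A sequence A satisfies the Dold condition as soon as, for every prime p, p^j ∣ m implies
-- p^(j+1) ∣ A(pm) − A(m): for n = pq with p^j ∣ q, pairing every divisor d of q prime to p with pd
-- turns the divisor sum into Σ μ(d)·(A(pq/d) − A(q/d)), and n divides what all its prime-power
-- divisors divide.
--
-- Every sequence aⁿ satisfies these congruences (Fermat's little theorem, then lifting the
-- exponent), hence so does (α − β)·Uₙ, and for p ∤ α − β the factor α − β cancels.
module Submission where

open import Defs
open import Algebra.Bundles using (CommutativeSemigroup)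
open import Algebra.Core using (Op₂)
import Algebra.Properties.CommutativeSemiring.Binomial as Binomial
open import Algebra.Structures using (IsCommutativeMonoid)
open import Data.Bool.Base using (true; false; if_then_else_)
open import Data.Bool.Properties using (⇔→≡; ¬-not)
open import Data.Empty using (⊥-elim)
open import Data.Fin.Base using (zero; suc; toℕ; inject₁; fromℕ)
open import Data.Fin.Properties using (toℕ-inject₁; toℕ-fromℕ; toℕ<n)
open import Data.Integer.Base as ℤ using (ℤ; +_; -[1+_]; _+_; _*_; _-_; -_; _^_; 0ℤ; 1ℤ)
import Data.Integer.DivMod as ℤ
open import Data.Integer.Divisibility.Signed as ℤ∣ using () renaming (_∣_ to _∣ℤ_)
import Data.Integer.Properties as ℤ
open import Data.Integer.Tactic.RingSolver using (solve-∀)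
open import Data.List.Base using ([]; _∷_; foldr; filter; map; upTo; applyUpTo; length)
open import Data.List.Membership.Propositional using (_∈_)
open import Data.List.Membership.Propositional.Properties
  using (∈-filter⁺; ∈-filter⁻; ∈-map⁺; ∈-upTo⁺)
open import Data.List.Properties using (map-upTo)
open import Data.List.Relation.Unary.All as All using (All; []; _∷_)
open import Data.Nat.Base as ℕ using (ℕ; zero; suc; _≤_; _<_; z≤n; s≤s; _!; NonZero)
open import Data.Nat.Combinatorics using (_C_; nCn≡1; nCk≡n!/k![n-k]!; k![n∸k]!∣n!)
open import Data.Nat.Coprimality using (Coprime; coprime-divisor)
open import Data.Nat.Divisibility
open import Data.Nat.DivMod using (_/_; m/n*n≡m; m*n/n≡m; m*n/m*o≡n/o)
open import Data.Nat.Induction using (<-wellFounded)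
open import Data.Nat.ListAction using (product)
open import Data.Nat.ListAction.Properties using (∈⇒∣product)
open import Data.Nat.Primality
  using (Prime; prime?; euclidsLemma; prime⇒irreducible; prime⇒nonZero; prime⇒nonTrivial; ¬prime[1])
open import Data.Nat.Primality.Factorisation using (factorise)
import Data.Nat.Properties as ℕ
open import Data.Product.Base using (∃; ∃₂; _×_; _,_; proj₁; proj₂)
open import Data.Sum.Base using (inj₁; inj₂)
open import Data.Vec.Functional using (Vector; init; last; tail)
open import Function.Base using (_∘_)
open import Function.Bundles using (_⇔_; mk⇔; Equivalence)
open import Function.Properties.Equivalence using () renaming (trans to ⇔-trans; sym to ⇔-sym)
open import Induction.WellFounded using (Acc; acc)
open import Level using (0ℓ)
open import Relation.Binary.PropositionalEquality
open import Relation.Nullary using (¬_; Dec; does; yes; no; _×-dec_)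
open import Relation.Nullary.Decidable using (⌊_⌋)
open import Relation.Unary using (Pred; Decidable; _⊆_)

open import Algebra.Properties.CommutativeSemigroup ℕ.*-commutativeSemigroup 
  using (x∙yz≈y∙xz; x∙yz≈xz∙y; xy∙z≈zx∙y)
open import Algebra.Definitions.RawSemiring ℤ.+-*-rawSemiring using () renaming (_^_ to _^ₛ_; _×_ to _×ₛ_)
open import Algebra.Properties.Monoid.Sum ℤ.+-0-monoid using (sum; sum-init-last)

-- Sums over ranges

foldr-filter : ∀ {A B : Set} {P : A → Set} (P? : Decidable P) (F : A → B → B) e xs →
               foldr F e (filter P? xs) ≡ foldr (λ x s → if does (P? x) then F x s else s) e xs
foldr-filter P? F e []       = refl
foldr-filter P? F e (x ∷ xs) with does (P? x)
... | true  = cong (F x) (foldr-filter P? F e xs)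
... | false = foldr-filter P? F e xs

if-yes : ∀ {A P : Set} (P? : Dec P) {x y : A} → P → (if does P? then x else y) ≡ x
if-yes (yes _) _ = refl
if-yes (no ¬p) p = ⊥-elim (¬p p)

if-no : ∀ {A P : Set} (P? : Dec P) {x y : A} → ¬ P → (if does P? then x else y) ≡ y
if-no (yes p) ¬p = ⊥-elim (¬p p)
if-no (no _)  _  = refl

module RangeSum {A : Set} {_∙_ : Op₂ A} {ε : A} (M : IsCommutativeMonoid _≡_ _∙_ ε) where

  open IsCommutativeMonoid M using (assoc; identityˡ; identityʳ; isCommutativeSemigroup)
  open ≡-Reasoning

  private
    commutativeSemigroup : CommutativeSemigroup 0ℓ 0ℓ
    commutativeSemigroup = record { isCommutativeSemigroup = isCommutativeSemigroup }

  open import Algebra.Properties.CommutativeSemigroup commutativeSemigroup using (interchange)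

  ∑< : ℕ → (ℕ → A) → A
  ∑< zero    f = ε
  ∑< (suc n) f = f 0 ∙ ∑< n (f ∘ suc)

  ∑<-cong : ∀ n {f g} → (∀ i → i < n → f i ≡ g i) → ∑< n f ≡ ∑< n g
  ∑<-cong zero    f≗g = refl
  ∑<-cong (suc n) f≗g = cong₂ _∙_ (f≗g 0 (s≤s z≤n)) (∑<-cong n (λ i i<n → f≗g (suc i) (s≤s i<n)))

  ∑<-zero : ∀ n {f} → (∀ i → i < n → f i ≡ ε) → ∑< n f ≡ ε
  ∑<-zero zero    f≗ε = refl
  ∑<-zero (suc n) f≗ε = begin
    _ ∙ _ ≡⟨ cong₂ _∙_ (f≗ε 0 (s≤s z≤n)) (∑<-zero n (λ i i<n → f≗ε (suc i) (s≤s i<n))) ⟩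
    ε ∙ ε ≡⟨ identityˡ ε ⟩
    ε     ∎

  ∑<-distrib : ∀ n f g → ∑< n (λ i → f i ∙ g i) ≡ ∑< n f ∙ ∑< n g
  ∑<-distrib zero    f g = sym (identityˡ ε)
  ∑<-distrib (suc n) f g = trans (cong ((f 0 ∙ g 0) ∙_) (∑<-distrib n (f ∘ suc) (g ∘ suc)))
                                 (interchange (f 0) (g 0) (∑< n (f ∘ suc)) (∑< n (g ∘ suc)))

  ∑<-split : ∀ m n f → ∑< (m ℕ.+ n) f ≡ ∑< m f ∙ ∑< n (λ i → f (m ℕ.+ i))
  ∑<-split zero    n f = sym (identityˡ _)
  ∑<-split (suc m) n f = trans (cong (f 0 ∙_) (∑<-split m n (f ∘ suc))) (sym (assoc _ _ _))

  ∑<-extend : ∀ {m n} f → m ≤ n → (∀ i → m ≤ i → f i ≡ ε) → ∑< n f ≡ ∑< m f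
  ∑<-extend {n = n}     f z≤n       f≗ε = ∑<-zero n (λ i _ → f≗ε i z≤n)
  ∑<-extend {n = suc n} f (s≤s m≤n) f≗ε =
    cong (f 0 ∙_) (∑<-extend (f ∘ suc) m≤n (λ i m≤i → f≗ε (suc i) (s≤s m≤i)))

  ∑<-single : ∀ {a n} f → a < n → (∀ i → i < n → i ≢ a → f i ≡ ε) → ∑< n f ≡ f a
  ∑<-single {zero}  {suc n} f _ f≗ε = begin
    f 0 ∙ ∑< n (f ∘ suc) ≡⟨ cong (f 0 ∙_) (∑<-zero n (λ i i<n → f≗ε (suc i) (s≤s i<n) (λ ()))) ⟩
    f 0 ∙ ε              ≡⟨ identityʳ (f 0) ⟩
    f 0                  ∎
  ∑<-single {suc a} {suc n} f (s≤s a<n) f≗ε = begin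
    f 0 ∙ ∑< n (f ∘ suc) ≡⟨ cong₂ _∙_ (f≗ε 0 (s≤s z≤n) (λ ())) (∑<-single (f ∘ suc) a<n f∘suc≗ε) ⟩
    ε ∙ f (suc a)        ≡⟨ identityˡ (f (suc a)) ⟩
    f (suc a)            ∎
    where
    f∘suc≗ε : ∀ i → i < n → i ≢ a → f (suc i) ≡ ε
    f∘suc≗ε i i<n i≢a = f≗ε (suc i) (s≤s i<n) (i≢a ∘ ℕ.suc-injective)

  ∑<-multiples : ∀ k q f → (∀ i → ¬ suc k ∣ i → f i ≡ ε) →
                 ∑< (suc k ℕ.* q) (f ∘ suc) ≡ ∑< q (λ e → f (suc k ℕ.* suc e))
  ∑<-multiples k zero    f f≗ε = cong (λ n → ∑< n (f ∘ suc)) (ℕ.*-zeroʳ k)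
  ∑<-multiples k (suc q) f f≗ε = begin
    ∑< (suc k ℕ.* suc q) (f ∘ suc)
      ≡⟨ cong (λ n → ∑< n (f ∘ suc)) (ℕ.*-suc (suc k) q) ⟩
    ∑< (suc k ℕ.+ suc k ℕ.* q) (f ∘ suc)
      ≡⟨ ∑<-split (suc k) _ (f ∘ suc) ⟩
    ∑< (suc k) (f ∘ suc) ∙ ∑< (suc k ℕ.* q) (λ i → f (suc (suc k ℕ.+ i)))
      ≡⟨ cong₂ _∙_ first (trans (∑<-cong (suc k ℕ.* q) (λ i _ → cong f (sym (ℕ.+-suc (suc k) i))))
                                (∑<-multiples k q (λ i → f (suc k ℕ.+ i)) shifted)) ⟩
    f (suc k) ∙ ∑< q (λ e → f (suc k ℕ.+ suc k ℕ.* suc e))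
      ≡⟨ cong₂ _∙_ (cong f (sym (ℕ.*-identityʳ (suc k))))
                   (∑<-cong q (λ e _ → cong f (sym (ℕ.*-suc (suc k) (suc e))))) ⟩
    ∑< (suc q) (λ e → f (suc k ℕ.* suc e))
      ∎
    where
    first : ∑< (suc k) (f ∘ suc) ≡ f (suc k)
    first = ∑<-single (f ∘ suc) (ℕ.n<1+n k) λ i i<1+k i≢k →
      f≗ε (suc i) (λ k∣i → i≢k (ℕ.≤-antisym (ℕ.≤-pred i<1+k) (ℕ.≤-pred (∣⇒≤ k∣i))))
    shifted : ∀ i → ¬ suc k ∣ i → f (suc k ℕ.+ i) ≡ ε
    shifted i k∤i = f≗ε (suc k ℕ.+ i) (λ k∣k+i → k∤i (∣m+n∣m⇒∣n k∣k+i ∣-refl))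

  ∑<-splitMultiples : ∀ k q f → (∀ d → q < d → ¬ suc k ∣ d → f d ≡ ε) →
    ∑< (suc k ℕ.* q) (f ∘ suc) ≡
    ∑< q (λ e → (if does (suc k ∣? suc e) then ε else f (suc e)) ∙ f (suc k ℕ.* suc e))
  ∑<-splitMultiples k q f f≗ε = begin
    ∑< n (f ∘ suc)
      ≡⟨ ∑<-cong n (λ i _ → split (suc k ∣? suc i) (f (suc i))) ⟩
    ∑< n (λ i → off (suc i) ∙ on (suc i))
      ≡⟨ ∑<-distrib n _ _ ⟩
    ∑< n (off ∘ suc) ∙ ∑< n (on ∘ suc)
      ≡⟨ cong₂ _∙_ (∑<-extend (off ∘ suc) (ℕ.m≤n*m q (suc k)) off-beyond)
                   (∑<-multiples k q on on-off-multiples) ⟩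
    ∑< q (off ∘ suc) ∙ ∑< q (λ e → on (suc k ℕ.* suc e))
      ≡⟨ cong (∑< q (off ∘ suc) ∙_) (∑<-cong q (λ e _ → on-multiple e)) ⟩
    ∑< q (off ∘ suc) ∙ ∑< q (λ e → f (suc k ℕ.* suc e))
      ≡⟨ ∑<-distrib q _ _ ⟨
    ∑< q (λ e → off (suc e) ∙ f (suc k ℕ.* suc e))
      ∎
    where
    n : ℕ
    n = suc k ℕ.* q
    off on : ℕ → A
    off d = if does (suc k ∣? d) then ε else f d
    on  d = if does (suc k ∣? d) then f d else ε
    split : ∀ {P : Set} (P? : Dec P) x → x ≡ (if does P? then ε else x) ∙ (if does P? then x else ε)
    split (yes _) x = sym (identityˡ x)
    split (no  _) x = sym (identityʳ x)
    else-ε : ∀ {P : Set} (P? : Dec P) {x} → (¬ P → x ≡ ε) → (if does P? then ε else x) ≡ ε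
    else-ε (yes _) _   = refl
    else-ε (no ¬p) x≡ε = x≡ε ¬p
    off-beyond : ∀ i → q ≤ i → off (suc i) ≡ ε
    off-beyond i q≤i = else-ε (suc k ∣? suc i) (f≗ε (suc i) (s≤s q≤i))
    on-off-multiples : ∀ d → ¬ suc k ∣ d → on d ≡ ε
    on-off-multiples d k∤d = if-no (suc k ∣? d) k∤d
    on-multiple : ∀ e → on (suc k ℕ.* suc e) ≡ f (suc k ℕ.* suc e)
    on-multiple e = if-yes (suc k ∣? suc k ℕ.* suc e) (m∣m*n (suc e))

  if-∙ : ∀ b x s → (if b then x ∙ s else s) ≡ (if b then x else ε) ∙ s
  if-∙ true  x s = refl
  if-∙ false x s = sym (identityˡ s)

  foldr-applyUpTo : ∀ {F : ℕ → A → A} h g n → (∀ i s → F (g i) s ≡ h (g i) ∙ s) →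
                    foldr F ε (applyUpTo g n) ≡ ∑< n (h ∘ g)
  foldr-applyUpTo     h g zero    F≗h∙ = refl
  foldr-applyUpTo {F} h g (suc n) F≗h∙ =
    trans (cong (F (g 0)) (foldr-applyUpTo h (g ∘ suc) n (F≗h∙ ∘ suc))) (F≗h∙ 0 _)

-- Primes

prime-∤-≢ : ∀ {p x} → Prime p → Prime x → x ≢ p → ¬ p ∣ x
prime-∤-≢ pp px x≢p p∣x with prime⇒irreducible px p∣x
... | inj₁ refl = ¬prime[1] pp
... | inj₂ refl = x≢p refl

∤⇒coprime : ∀ {p m} → Prime p → ¬ p ∣ m → Coprime m p
∤⇒coprime pp p∤m (i∣m , i∣p) with prime⇒irreducible pp i∣p
... | inj₁ i≡1  = i≡1
... | inj₂ refl = ⊥-elim (p∤m i∣m)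

∣p*n⇒∣n : ∀ {p m} n → Prime p → ¬ p ∣ m → m ∣ p ℕ.* n → m ∣ n
∣p*n⇒∣n n pp p∤m = coprime-divisor (∤⇒coprime pp p∤m)

prime^∣-cancelˡ : ∀ {p m} e n → Prime p → ¬ p ∣ m → p ℕ.^ e ∣ m ℕ.* n → p ℕ.^ e ∣ n
prime^∣-cancelˡ zero n pp p∤m _ = 1∣ n
prime^∣-cancelˡ {p} {m} (suc e) n pp p∤m p^e+1∣mn with euclidsLemma m n pp (∣-trans (m∣m*n (p ℕ.^ e)) p^e+1∣mn)
... | inj₁ p∣m = ⊥-elim (p∤m p∣m)
... | inj₂ (divides n′ refl) =
  subst (p ℕ.^ suc e ∣_) (ℕ.*-comm p n′) (*-monoʳ-∣ p (prime^∣-cancelˡ e n′ pp p∤m p^e∣mn′))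
  where
  p^e∣mn′ : p ℕ.^ e ∣ m ℕ.* n′
  p^e∣mn′ = *-cancelˡ-∣ p {{prime⇒nonZero pp}}
    (subst (p ℕ.* p ℕ.^ e ∣_) (trans (sym (ℕ.*-assoc m n′ p)) (ℕ.*-comm (m ℕ.* n′) p)) p^e+1∣mn)

prime^∣∧∣⇒∣ : ∀ {p m x} e → Prime p → ¬ p ∣ m → p ℕ.^ e ∣ x → m ∣ x → p ℕ.^ e ℕ.* m ∣ x
prime^∣∧∣⇒∣ {p} {m} e pp p∤m p^e∣x (divides t refl) =
  *-monoˡ-∣ m (prime^∣-cancelˡ e t pp p∤m (subst (p ℕ.^ e ∣_) (ℕ.*-comm t m) p^e∣x))

primeFactor : ∀ {n} → 1 < n → ∃ λ p → Prime p × p ∣ n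
primeFactor {n} 1<n with factorise n {{ℕ.>-nonZero (ℕ.<-trans ℕ.z<s 1<n)}}
... | record { factors = [] ; isFactorisation = n≡1 } = ⊥-elim (ℕ.<-irrefl (sym n≡1) 1<n)
... | record { factors = p ∷ ps ; isFactorisation = n≡p*ps ; factorsPrime = pp ∷ _ } =
  p , pp , subst (p ∣_) (sym n≡p*ps) (m∣m*n (product ps))

decompose : ∀ {p} n .{{_ : NonZero n}} → Prime p → Acc _<_ n → ∃₂ λ e m → n ≡ p ℕ.^ e ℕ.* m × ¬ p ∣ m
decompose {p} n pp (acc rec) with p ∣? n
... | no p∤n = 0 , n , sym (ℕ.*-identityˡ n) , p∤n
... | yes (divides n′ refl) = extend (decompose n′ pp (rec n′<n))
  where
  instance
    n′≢0 : NonZero n′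
    n′≢0 = ℕ.m*n≢0⇒m≢0 n′
  n′<n : n′ < n′ ℕ.* p
  n′<n = ℕ.m<m*n n′ p (ℕ.nonTrivial⇒n>1 p {{prime⇒nonTrivial pp}})
  extend : (∃₂ λ e m → n′ ≡ p ℕ.^ e ℕ.* m × ¬ p ∣ m) →
           ∃₂ λ e m → n′ ℕ.* p ≡ p ℕ.^ e ℕ.* m × ¬ p ∣ m
  extend (e , m , n′≡p^e*m , p∤m) = suc e , m , trans (cong (ℕ._* p) n′≡p^e*m) (xy∙z≈zx∙y (p ℕ.^ e) m p) , p∤m

∣-byPrimePowers : ∀ n .{{_ : NonZero n}} x → (∀ p e → Prime p → p ℕ.^ suc e ∣ n → p ℕ.^ suc e ∣ x) → n ∣ x
∣-byPrimePowers n x = go n (<-wellFounded n)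
  where
  go : ∀ n .{{_ : NonZero n}} → Acc _<_ n → (∀ p e → Prime p → p ℕ.^ suc e ∣ n → p ℕ.^ suc e ∣ x) → n ∣ x
  go 1 _ _ = 1∣ x
  go n@(suc (suc _)) (acc rec) local with primeFactor {n} (ℕ.s≤s (ℕ.s≤s ℕ.z≤n))
  ... | p , pp , p∣n with decompose n pp (<-wellFounded n)
  ...   | zero  , m , n≡m , p∤m = ⊥-elim (p∤m (subst (p ∣_) (trans n≡m (ℕ.*-identityˡ m)) p∣n))
  ...   | suc e , m , n≡p^e+1*m , p∤m = subst (_∣ x) (sym n≡p^e+1*m)
          (prime^∣∧∣⇒∣ (suc e) pp p∤m (local p e pp p^e+1∣n) (go m (rec m<n) local′))
    where
    p^e+1∣n : p ℕ.^ suc e ∣ n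
    p^e+1∣n = subst (p ℕ.^ suc e ∣_) (sym n≡p^e+1*m) (m∣m*n m)
    m∣n : m ∣ n
    m∣n = subst (m ∣_) (sym n≡p^e+1*m) (n∣m*n (p ℕ.^ suc e))
    local′ : ∀ q f → Prime q → q ℕ.^ suc f ∣ m → q ℕ.^ suc f ∣ x
    local′ q f pq q^f+1∣m = local q f pq (∣-trans q^f+1∣m m∣n)
    instance
      m≢0 : NonZero m
      m≢0 = ℕ.m*n≢0⇒n≢0 (p ℕ.^ suc e) {{subst NonZero n≡p^e+1*m _}}
    1<p^e+1 : 1 < p ℕ.^ suc e
    1<p^e+1 = ℕ.^-monoʳ-< p (ℕ.nonTrivial⇒n>1 p {{prime⇒nonTrivial pp}}) {0} {suc e} ℕ.z<s
    m<n : m < n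
    m<n = subst (m <_) (trans (ℕ.*-comm m (p ℕ.^ suc e)) (sym n≡p^e+1*m)) (ℕ.m<m*n m (p ℕ.^ suc e) 1<p^e+1)

-- The Möbius function

private module ℕ∑ = RangeSum ℕ.+-0-isCommutativeMonoid

primeDivisor? : ∀ n → Decidable (λ x → Prime x × x ∣ n)
primeDivisor? n x = prime? x ×-dec x ∣? n

filter-filter-⊆ : ∀ {P Q : Pred ℕ 0ℓ} (P? : Decidable P) (Q? : Decidable Q) → P ⊆ Q →
                  ∀ xs → filter P? (filter Q? xs) ≡ filter P? xs
filter-filter-⊆ P? Q? P⊆Q []       = refl
filter-filter-⊆ P? Q? P⊆Q (x ∷ xs) with Q? x
... | yes _ with P? x
...   | yes _ = cong (x ∷_) (filter-filter-⊆ P? Q? P⊆Q xs)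
...   | no  _ = filter-filter-⊆ P? Q? P⊆Q xs
filter-filter-⊆ P? Q? P⊆Q (x ∷ xs) | no ¬qx with P? x
...   | yes px = ⊥-elim (¬qx (P⊆Q px))
...   | no  _  = filter-filter-⊆ P? Q? P⊆Q xs

primeDivisors≡ : ∀ n → primeDivisors n ≡ filter (primeDivisor? n) (map suc (upTo n))
primeDivisors≡ n = filter-filter-⊆ (primeDivisor? n) (_∣? n) proj₂ (map suc (upTo n))

∈-primeDivisors⁺ : ∀ {n p} .{{_ : NonZero n}} → Prime p → p ∣ n → p ∈ primeDivisors n
∈-primeDivisors⁺ {n} {suc p} pp p∣n = subst (suc p ∈_) (sym (primeDivisors≡ n))
  (∈-filter⁺ (primeDivisor? n) (∈-map⁺ suc (∈-upTo⁺ (∣⇒≤ p∣n))) (pp , p∣n))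

∈-primeDivisors⁻ : ∀ {n p} → p ∈ primeDivisors n → Prime p × p ∣ n
∈-primeDivisors⁻ {n} = proj₂ ∘ ∈-filter⁻ (primeDivisor? n) {xs = divisors n}

∣⇒∣rad : ∀ {m p} .{{_ : NonZero ℤ.∣ m ∣}} → Prime p → p ∣ ℤ.∣ m ∣ → p ∣ rad m
∣⇒∣rad pp p∣m = ∈⇒∣product (∈-primeDivisors⁺ pp p∣m)

indicator : ∀ {A : Set} → Dec A → ℕ
indicator A? = if does A? then 1 else 0

indicator-⇔ : ∀ {A B : Set} (A? : Dec A) (B? : Dec B) → A ⇔ B → indicator A? ≡ indicator B?
indicator-⇔ (yes a) B? A⇔B = sym (if-yes B? (Equivalence.to A⇔B a))
indicator-⇔ (no ¬a) B? A⇔B = sym (if-no B? (¬a ∘ Equivalence.from A⇔B))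

length-primeDivisors : ∀ {n m} .{{_ : NonZero n}} → n ≤ m →
  length (primeDivisors n) ≡ ℕ∑.∑< m (λ i → indicator (primeDivisor? n (suc i)))
length-primeDivisors {n} {m} n≤m = begin
  length (primeDivisors n)
    ≡⟨ cong length (primeDivisors≡ n) ⟩
  length (filter (primeDivisor? n) (map suc (upTo n)))
    ≡⟨ foldr-filter (primeDivisor? n) _ 0 (map suc (upTo n)) ⟩
  foldr (λ x s → if does (primeDivisor? n x) then suc s else s) 0 (map suc (upTo n))
    ≡⟨ cong (foldr _ 0) (map-upTo suc n) ⟩
  foldr (λ x s → if does (primeDivisor? n x) then suc s else s) 0 (applyUpTo suc n)
    ≡⟨ ℕ∑.foldr-applyUpTo (indicator ∘ primeDivisor? n) suc n (λ i → ℕ∑.if-∙ (does (primeDivisor? n (suc i))) 1) ⟩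
  ℕ∑.∑< n (λ i → indicator (primeDivisor? n (suc i)))
    ≡⟨ ℕ∑.∑<-extend _ n≤m beyond ⟨
  ℕ∑.∑< m (λ i → indicator (primeDivisor? n (suc i)))
    ∎
  where
  open ≡-Reasoning
  beyond : ∀ i → n ≤ i → indicator (primeDivisor? n (suc i)) ≡ 0
  beyond i n≤i = if-no (primeDivisor? n (suc i)) (λ (_ , i+1∣n) → ℕ.<⇒≱ (ℕ.s≤s n≤i) (∣⇒≤ i+1∣n))

primeDivisor?-* : ∀ {p d} → Prime p → ¬ p ∣ d → ∀ x →
  indicator (primeDivisor? (p ℕ.* d) x) ≡ indicator (x ℕ.≟ p) ℕ.+ indicator (primeDivisor? d x)
primeDivisor?-* {p} {d} pp p∤d x with x ℕ.≟ p
... | yes refl = begin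
  indicator (primeDivisor? (p ℕ.* d) p)
    ≡⟨ if-yes (primeDivisor? (p ℕ.* d) p) (pp , m∣m*n d) ⟩
  1 ℕ.+ 0
    ≡⟨ cong₂ ℕ._+_ (if-yes (p ℕ.≟ p) refl) (if-no (primeDivisor? d p) (p∤d ∘ proj₂)) ⟨
  indicator (p ℕ.≟ p) ℕ.+ indicator (primeDivisor? d p)
    ∎
  where open ≡-Reasoning
... | no x≢p = begin
  indicator (primeDivisor? (p ℕ.* d) x)
    ≡⟨ indicator-⇔ (primeDivisor? (p ℕ.* d) x) (primeDivisor? d x) x∣pd⇔x∣d ⟩
  0 ℕ.+ indicator (primeDivisor? d x)
    ≡⟨ cong (ℕ._+ _) (if-no (x ℕ.≟ p) x≢p) ⟨
  indicator (x ℕ.≟ p) ℕ.+ indicator (primeDivisor? d x)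
    ∎
  where
  open ≡-Reasoning
  x∣pd⇔x∣d : (Prime x × x ∣ p ℕ.* d) ⇔ (Prime x × x ∣ d)
  x∣pd⇔x∣d = mk⇔ (λ (px , x∣pd) → px , ∣p*n⇒∣n d pp (prime-∤-≢ pp px x≢p) x∣pd)
                 (λ (px , x∣d) → px , ∣n⇒∣m*n p x∣d)

length-primeDivisors-* : ∀ {p d} .{{_ : NonZero d}} → Prime p → ¬ p ∣ d →
  length (primeDivisors (p ℕ.* d)) ≡ suc (length (primeDivisors d))
length-primeDivisors-* {suc p} {d} pp p∤d = begin
  length (primeDivisors n)
    ≡⟨ length-primeDivisors {n} ℕ.≤-refl ⟩
  ℕ∑.∑< n (λ i → indicator (primeDivisor? n (suc i)))
    ≡⟨ ℕ∑.∑<-cong n (λ i _ → primeDivisor?-* pp p∤d (suc i)) ⟩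
  ℕ∑.∑< n (λ i → indicator (suc i ℕ.≟ suc p) ℕ.+ indicator (primeDivisor? d (suc i)))
    ≡⟨ ℕ∑.∑<-distrib n _ _ ⟩
  ℕ∑.∑< n (λ i → indicator (suc i ℕ.≟ suc p)) ℕ.+ ℕ∑.∑< n (λ i → indicator (primeDivisor? d (suc i)))
    ≡⟨ cong₂ ℕ._+_ only-p (sym (length-primeDivisors (ℕ.m≤n*m d (suc p)))) ⟩
  1 ℕ.+ length (primeDivisors d)
    ∎
  where
  open ≡-Reasoning
  n : ℕ
  n = suc p ℕ.* d
  instance
    n≢0 : NonZero n
    n≢0 = ℕ.m*n≢0 (suc p) d
  only-p : ℕ∑.∑< n (λ i → indicator (suc i ℕ.≟ suc p)) ≡ 1
  only-p = trans (ℕ∑.∑<-single _ (ℕ.m≤m*n (suc p) d) λ i _ i≢p →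
                   if-no (suc i ℕ.≟ suc p) (i≢p ∘ ℕ.suc-injective))
                 (if-yes (suc p ℕ.≟ suc p) refl)

SquareFree : ℕ → Set
SquareFree n = ∀ {x} → Prime x → ¬ x ℕ.* x ∣ n

squarefree-foldr⇔ : ∀ n xs →
  foldr (λ p b → if ⌊ p ℕ.* p ∣? n ⌋ then false else b) true xs ≡ true ⇔ All (λ x → ¬ x ℕ.* x ∣ n) xs
squarefree-foldr⇔ n []       = mk⇔ (λ _ → []) (λ _ → refl)
squarefree-foldr⇔ n (x ∷ xs) with x ℕ.* x ∣? n
... | yes xx∣n = mk⇔ (λ ()) (λ all → ⊥-elim (All.head all xx∣n))
... | no  xx∤n = mk⇔ (λ eq → xx∤n ∷ Equivalence.to (squarefree-foldr⇔ n xs) eq)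
                     (λ all → Equivalence.from (squarefree-foldr⇔ n xs) (All.tail all))

squarefree⇔ : ∀ {n} .{{_ : NonZero n}} → squarefree n ≡ true ⇔ SquareFree n
squarefree⇔ {n} = ⇔-trans (squarefree-foldr⇔ n (primeDivisors n)) (mk⇔
  (λ all {x} px xx∣n → All.lookup all (∈-primeDivisors⁺ px (∣-trans (m∣m*n x) xx∣n)) xx∣n)
  (λ sqf → All.tabulate (λ x∈ → sqf (proj₁ (∈-primeDivisors⁻ {n} x∈)))))

SquareFree-*⇔ : ∀ {p d} → Prime p → ¬ p ∣ d → SquareFree (p ℕ.* d) ⇔ SquareFree d
SquareFree-*⇔ {p} {d} pp p∤d = mk⇔ (λ sqf {x} px xx∣d → sqf px (∣n⇒∣m*n p xx∣d)) (λ sqf {x} → square∤pd sqf)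
  where
  square∤pd : SquareFree d → ∀ {x} → Prime x → ¬ x ℕ.* x ∣ p ℕ.* d
  square∤pd sqf {x} px xx∣pd with x ℕ.≟ p
  ... | yes refl = p∤d (*-cancelˡ-∣ p {{prime⇒nonZero pp}} xx∣pd)
  ... | no x≢p = sqf px (∣p*n⇒∣n d pp p∤xx xx∣pd)
    where
    p∤xx : ¬ p ∣ x ℕ.* x
    p∤xx p∣xx with euclidsLemma x x pp p∣xx
    ... | inj₁ p∣x = prime-∤-≢ pp px x≢p p∣x
    ... | inj₂ p∣x = prime-∤-≢ pp px x≢p p∣x

squarefree-*-∤ : ∀ {p d} .{{_ : NonZero d}} → Prime p → ¬ p ∣ d → squarefree (p ℕ.* d) ≡ squarefree d
squarefree-*-∤ {p} {d} pp p∤d =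
  ⇔→≡ (⇔-trans squarefree⇔ (⇔-trans (SquareFree-*⇔ pp p∤d) (⇔-sym squarefree⇔)))
  where
  instance
    pd≢0 : NonZero (p ℕ.* d)
    pd≢0 = ℕ.m*n≢0 p d {{prime⇒nonZero pp}}

squarefree-*-∣ : ∀ {p d} .{{_ : NonZero d}} → Prime p → p ∣ d → squarefree (p ℕ.* d) ≡ false
squarefree-*-∣ {p} {d} pp p∣d = ¬-not (λ sqf → Equivalence.to squarefree⇔ sqf pp (*-monoʳ-∣ p p∣d))
  where
  instance
    pd≢0 : NonZero (p ℕ.* d)
    pd≢0 = ℕ.m*n≢0 p d {{prime⇒nonZero pp}}

μ-*-∣ : ∀ {p d} .{{_ : NonZero d}} → Prime p → p ∣ d → μ (p ℕ.* d) ≡ 0ℤ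
μ-*-∣ pp p∣d rewrite squarefree-*-∣ pp p∣d = refl

μ-*-∤ : ∀ {p d} .{{_ : NonZero d}} → Prime p → ¬ p ∣ d → μ (p ℕ.* d) ≡ - μ d
μ-*-∤ {d = d} pp p∤d rewrite squarefree-*-∤ pp p∤d | length-primeDivisors-* pp p∤d with squarefree d
... | true  = ℤ.-1*i≡-i _
... | false = refl

-- The Dold condition from congruences at prime powers

open RangeSum ℤ.+-0-isCommutativeMonoid

∑<-∣ : ∀ {m} n f → (∀ i → i < n → m ∣ℤ f i) → m ∣ℤ ∑< n f
∑<-∣ zero    f m∣f = ℤ∣.divides 0ℤ refl
∑<-∣ (suc n) f m∣f =
  ℤ∣.∣m∣n⇒∣m+n (m∣f 0 ℕ.z<s) (∑<-∣ n (f ∘ suc) (λ i i<n → m∣f (suc i) (ℕ.s<s i<n)))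

record GaussAt (p : ℕ) (A : ℕ → ℤ) : Set where
  field
    congruence : ∀ j m → p ℕ.^ j ∣ m → + (p ℕ.^ suc j) ∣ℤ A (p ℕ.* m) - A m

open GaussAt public

doldTerm : (ℕ → ℤ) → ℕ → ℕ → ℤ
doldTerm A n zero    = 0ℤ
doldTerm A n (suc d) = if does (suc d ∣? n) then μ (suc d) * A (n / suc d) else 0ℤ

doldSum≡∑< : ∀ A n → doldSum A n ≡ ∑< n (doldTerm A n ∘ suc)
doldSum≡∑< A n = begin
  doldSum A n                   ≡⟨ foldr-filter (_∣? n) _ 0ℤ (map suc (upTo n)) ⟩
  foldr _ 0ℤ (map suc (upTo n)) ≡⟨ cong (foldr _ 0ℤ) (map-upTo suc n) ⟩
  foldr _ 0ℤ (applyUpTo suc n)  ≡⟨ foldr-applyUpTo (doldTerm A n) suc n (λ i → if-∙ (does (suc i ∣? n)) _) ⟩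
  ∑< n (doldTerm A n ∘ suc)     ∎
  where open ≡-Reasoning

doldTerm-∤ : ∀ A {n} d → ¬ d ∣ n → doldTerm A n d ≡ 0ℤ
doldTerm-∤ A     zero    _   = refl
doldTerm-∤ A {n} (suc d) d∤n = if-no (suc d ∣? n) d∤n

doldTerm-∣ : ∀ A {n} d .{{_ : NonZero d}} → d ∣ n → doldTerm A n d ≡ μ d * A (n / d)
doldTerm-∣ A {n} (suc d) d∣n = if-yes (suc d ∣? n) d∣n

doldTerm-μ≡0 : ∀ A n d → μ d ≡ 0ℤ → doldTerm A n d ≡ 0ℤ
doldTerm-μ≡0 A n zero    _   = refl
doldTerm-μ≡0 A n (suc d) μ≡0 = if-0 (does (suc d ∣? n)) (cong (_* A (n / suc d)) μ≡0)
  where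
  if-0 : ∀ b {x} → x ≡ 0ℤ → (if b then x else 0ℤ) ≡ 0ℤ
  if-0 true  x≡0 = x≡0
  if-0 false _   = refl

pairedTerm-∣ : ∀ {A p j q} → Prime p → GaussAt p A → p ℕ.^ j ∣ q → ∀ d .{{_ : NonZero d}} →
  + (p ℕ.^ suc j) ∣ℤ (if does (p ∣? d) then 0ℤ else doldTerm A (p ℕ.* q) d) + doldTerm A (p ℕ.* q) (p ℕ.* d)
pairedTerm-∣ {A} {p} {j} {q} pp gauss p^j∣q d with p ∣? d
... | yes p∣d = subst (_ ∣ℤ_) (sym (trans (ℤ.+-identityˡ _) (doldTerm-μ≡0 A _ (p ℕ.* d) (μ-*-∣ pp p∣d))))
                      (ℤ∣.divides 0ℤ refl)
... | no p∤d with d ∣? q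
...   | no d∤q = subst (_ ∣ℤ_) (sym (cong₂ _+_ (doldTerm-∤ A d (d∤q ∘ ∣p*n⇒∣n q pp p∤d))
                                               (doldTerm-∤ A (p ℕ.* d) (d∤q ∘ *-cancelˡ-∣ p {{prime⇒nonZero pp}}))))
                        (ℤ∣.divides 0ℤ refl)
...   | yes (divides c refl) = subst (_ ∣ℤ_) (sym paired≡) (ℤ∣.∣n⇒∣m*n (μ d) (congruence gauss j c p^j∣c))
  where
  instance
    pd≢0 : NonZero (p ℕ.* d)
    pd≢0 = ℕ.m*n≢0 p d {{prime⇒nonZero pp}}
  p^j∣c : p ℕ.^ j ∣ c
  p^j∣c = prime^∣-cancelˡ j c pp p∤d (subst (p ℕ.^ j ∣_) (ℕ.*-comm c d) p^j∣q)
  n/d : p ℕ.* (c ℕ.* d) / d ≡ p ℕ.* c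
  n/d = trans (cong (_/ d) (sym (ℕ.*-assoc p c d))) (m*n/n≡m (p ℕ.* c) d)
  n/pd : p ℕ.* (c ℕ.* d) / (p ℕ.* d) ≡ c
  n/pd = trans (m*n/m*o≡n/o p (c ℕ.* d) d) (m*n/n≡m c d)
  factor : ∀ m a b → m * a + - m * b ≡ m * (a - b)
  factor = solve-∀
  paired≡ : doldTerm A (p ℕ.* (c ℕ.* d)) d + doldTerm A (p ℕ.* (c ℕ.* d)) (p ℕ.* d) ≡ μ d * (A (p ℕ.* c) - A c)
  paired≡ = begin
    doldTerm A (p ℕ.* (c ℕ.* d)) d + doldTerm A (p ℕ.* (c ℕ.* d)) (p ℕ.* d)
      ≡⟨ cong₂ _+_ (doldTerm-∣ A d (∣n⇒∣m*n p (n∣m*n c))) (doldTerm-∣ A (p ℕ.* d) (*-monoʳ-∣ p (n∣m*n c))) ⟩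
    μ d * A (p ℕ.* (c ℕ.* d) / d) + μ (p ℕ.* d) * A (p ℕ.* (c ℕ.* d) / (p ℕ.* d))
      ≡⟨ cong₂ (λ x y → μ d * A x + y * A (p ℕ.* (c ℕ.* d) / (p ℕ.* d))) n/d (μ-*-∤ pp p∤d) ⟩
    μ d * A (p ℕ.* c) + - μ d * A (p ℕ.* (c ℕ.* d) / (p ℕ.* d))
      ≡⟨ cong (λ x → μ d * A (p ℕ.* c) + - μ d * A x) n/pd ⟩
    μ d * A (p ℕ.* c) + - μ d * A c
      ≡⟨ factor (μ d) (A (p ℕ.* c)) (A c) ⟩
    μ d * (A (p ℕ.* c) - A c)
      ∎
    where open ≡-Reasoning

GaussAt⇒∣doldSum : ∀ {A p j q} .{{_ : NonZero q}} → Prime p → GaussAt p A → p ℕ.^ j ∣ q →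
                   + (p ℕ.^ suc j) ∣ℤ doldSum A (p ℕ.* q)
GaussAt⇒∣doldSum {A} {suc k} {j} {q} pp gauss p^j∣q =
  subst (_ ∣ℤ_) (sym (trans (doldSum≡∑< A n) (∑<-splitMultiples k q (doldTerm A n) beyond)))
    (∑<-∣ q _ (λ e _ → pairedTerm-∣ {A} {j = j} pp gauss p^j∣q (suc e)))
  where
  n : ℕ
  n = suc k ℕ.* q
  beyond : ∀ d → q < d → ¬ suc k ∣ d → doldTerm A n d ≡ 0ℤ
  beyond d q<d p∤d = doldTerm-∤ A d (λ d∣n → ℕ.<⇒≱ q<d (∣⇒≤ (∣p*n⇒∣n q pp p∤d d∣n)))

gauss⇒dold : ∀ {A} → (∀ p → Prime p → GaussAt p A) → Dold A
gauss⇒dold {A} gauss n {{n≢0}} = ∣-byPrimePowers n ℤ.∣ doldSum A n ∣ local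
  where
  local : ∀ p e → Prime p → p ℕ.^ suc e ∣ n → p ℕ.^ suc e ∣ ℤ.∣ doldSum A n ∣
  local p e pp (divides t n≡t*p^e+1) = subst (λ m → p ℕ.^ suc e ∣ ℤ.∣ doldSum A m ∣) (sym n≡p*q)
    (ℤ∣.∣⇒∣ᵤ (GaussAt⇒∣doldSum {A} {j = e} pp (gauss p pp) (n∣m*n t)))
    where
    q : ℕ
    q = t ℕ.* p ℕ.^ e
    n≡p*q : n ≡ p ℕ.* q
    n≡p*q = trans n≡t*p^e+1 (x∙yz≈y∙xz t p (p ℕ.^ e))
    instance
      q≢0 : NonZero q
      q≢0 = ℕ.m*n≢0⇒n≢0 p {{subst NonZero n≡p*q n≢0}}

GaussAt-cong : ∀ {p A B} → (∀ n → A n ≡ B n) → GaussAt p A → GaussAt p B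
GaussAt-cong {p} A≗B gauss .congruence j m p^j∣m =
  subst₂ (λ a b → + (p ℕ.^ suc j) ∣ℤ a - b) (A≗B (p ℕ.* m)) (A≗B m) (congruence gauss j m p^j∣m)

GaussAt-*ˡ : ∀ {p A} c → GaussAt p A → GaussAt p (λ n → c * A n)
GaussAt-*ˡ {A = A} c gauss .congruence j m p^j∣m =
  subst (_ ∣ℤ_) (factor c (A _) (A m)) (ℤ∣.∣n⇒∣m*n c (congruence gauss j m p^j∣m))
  where
  factor : ∀ c a b → c * (a - b) ≡ c * a - c * b
  factor = solve-∀

GaussAt-+ : ∀ {p A B} → GaussAt p A → GaussAt p B → GaussAt p (λ n → A n + B n)
GaussAt-+ {A = A} {B} gaussA gaussB .congruence j m p^j∣m = subst (_ ∣ℤ_) (regroup (A _) (A m) (B _) (B m))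
  (ℤ∣.∣m∣n⇒∣m+n (congruence gaussA j m p^j∣m) (congruence gaussB j m p^j∣m))
  where
  regroup : ∀ a a′ b b′ → (a - a′) + (b - b′) ≡ (a + b) - (a′ + b′)
  regroup = solve-∀

GaussAt-cancel : ∀ {p A} k → Prime p → ¬ p ∣ ℤ.∣ k ∣ → GaussAt p (λ n → k * A n) → GaussAt p A
GaussAt-cancel {p} {A} k pp p∤k gauss .congruence j m p^j∣m =
  ℤ∣.∣ᵤ⇒∣ (prime^∣-cancelˡ (suc j) ℤ.∣ A (p ℕ.* m) - A m ∣ pp p∤k
    (subst (p ℕ.^ suc j ∣_) (ℤ.abs-* k _) p^j+1∣k*D))
  where
  factor : ∀ c a b → c * a - c * b ≡ c * (a - b)
  factor = solve-∀
  p^j+1∣k*D : p ℕ.^ suc j ∣ ℤ.∣ k * (A (p ℕ.* m) - A m) ∣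
  p^j+1∣k*D = ℤ∣.∣⇒∣ᵤ (subst (_ ∣ℤ_) (factor k (A _) (A m)) (congruence gauss j m p^j∣m))

-- Powers

*-pres-∣ℤ : ∀ {a b c d} → a ∣ℤ b → c ∣ℤ d → a * c ∣ℤ b * d
*-pres-∣ℤ {b = b} {c} a∣b c∣d = ℤ∣.∣-trans (ℤ∣.*-monoˡ-∣ c a∣b) (ℤ∣.*-monoʳ-∣ b c∣d)

pos-^-suc : ∀ p t → + (p ℕ.^ t) * + p ≡ + (p ℕ.^ suc t)
pos-^-suc p t = trans (sym (ℤ.pos-* (p ℕ.^ t) p)) (cong +_ (ℕ.*-comm (p ℕ.^ t) p))

^-^ : ∀ a m n → (a ^ m) ^ n ≡ a ^ (n ℕ.* m)
^-^ a m n = trans (ℤ.^-*-assoc a m n) (cong (a ^_) (ℕ.*-comm m n))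

prime∤! : ∀ {p n} → Prime p → n < p → ¬ p ∣ n !
prime∤! {n = zero}  pp _   p∣1 = ¬prime[1] (subst Prime (∣1⇒≡1 p∣1) pp)
prime∤! {n = suc n} pp n<p p∣n! with euclidsLemma (suc n) (n !) pp p∣n!
... | inj₁ p∣n+1 = ℕ.<⇒≱ n<p (∣⇒≤ p∣n+1)
... | inj₂ p∣n!  = prime∤! pp (ℕ.<-trans (ℕ.n<1+n n) n<p) p∣n!

n∣n! : ∀ n .{{_ : NonZero n}} → n ∣ n !
n∣n! (suc n) = m∣m*n (n !)

C*k!*[n-k]!≡n! : ∀ {n k} → k ≤ n → (n C k) ℕ.* (k ! ℕ.* (n ℕ.∸ k) !) ≡ n !
C*k!*[n-k]!≡n! {n} {k} k≤n = trans (cong (ℕ._* (k ! ℕ.* (n ℕ.∸ k) !)) (nCk≡n!/k![n-k]! k≤n))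
                                   (m/n*n≡m {{ℕ._!*_!≢0 k (n ℕ.∸ k)}} (k![n∸k]!∣n! k≤n))

prime∣C : ∀ {p k} → Prime p → 0 < k → k < p → p ∣ p C k
prime∣C {p} {k} pp 0<k k<p with euclidsLemma (p C k) (k ! ℕ.* (p ℕ.∸ k) !) pp p∣C*k!*[p-k]!
  where
  p∣C*k!*[p-k]! : p ∣ (p C k) ℕ.* (k ! ℕ.* (p ℕ.∸ k) !)
  p∣C*k!*[p-k]! = subst (p ∣_) (sym (C*k!*[n-k]!≡n! (ℕ.<⇒≤ k<p))) (n∣n! p {{prime⇒nonZero pp}})
... | inj₁ p∣C = p∣C
... | inj₂ p∣k!*[p-k]! with euclidsLemma (k !) ((p ℕ.∸ k) !) pp p∣k!*[p-k]!
...   | inj₁ p∣k!     = ⊥-elim (prime∤! pp k<p p∣k!)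
...   | inj₂ p∣[p-k]! = ⊥-elim (prime∤! pp (ℕ.∸-monoʳ-< 0<k (ℕ.<⇒≤ k<p)) p∣[p-k]!)

-- The binomial theorem of the standard library is stated with the generic _^_ and _×_ of a semiring.

^ₛ≡^ : ∀ x n → x ^ₛ n ≡ x ^ n
^ₛ≡^ x zero    = refl
^ₛ≡^ x (suc n) = cong (x *_) (^ₛ≡^ x n)

×ₛ≡* : ∀ n x → n ×ₛ x ≡ + n * x
×ₛ≡* zero    x = refl
×ₛ≡* (suc n) x = begin
  x + n ×ₛ x        ≡⟨ cong₂ _+_ (sym (ℤ.*-identityˡ x)) (×ₛ≡* n x) ⟩
  1ℤ * x + + n * x  ≡⟨ ℤ.*-distribʳ-+ x 1ℤ (+ n) ⟨
  (1ℤ + + n) * x    ≡⟨ cong (_* x) (ℤ.pos-+ 1 n) ⟨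
  + suc n * x       ∎
  where open ≡-Reasoning

sum-∣ : ∀ {m n} (t : Vector ℤ n) → (∀ i → m ∣ℤ t i) → m ∣ℤ sum t
sum-∣ {n = zero}  t _   = ℤ∣.divides 0ℤ refl
sum-∣ {n = suc n} t m∣t = ℤ∣.∣m∣n⇒∣m+n (m∣t zero) (sum-∣ (tail t) (m∣t ∘ suc))

freshmansDream : ∀ {p} → Prime p → ∀ x y → + p ∣ℤ (x + y) ^ p - x ^ p - y ^ p
freshmansDream {suc p} pp x y = subst (+ suc p ∣ℤ_) inner≡ (sum-∣ (init (tail t)) p∣inner)
  where
  open ≡-Reasoning
  open Binomial ℤ.+-*-commutativeSemiring using (theorem; binomialTerm)
  t : Vector ℤ (suc (suc p))
  t = binomialTerm x y (suc p)
  inner : ℤ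
  inner = sum (init (tail t))
  term : ∀ k → (suc p C k) ×ₛ (x ^ₛ k * y ^ₛ (suc p ℕ.∸ k)) ≡ + (suc p C k) * (x ^ k * y ^ (suc p ℕ.∸ k))
  term k = trans (×ₛ≡* (suc p C k) _) (cong (+ (suc p C k) *_) (cong₂ _*_ (^ₛ≡^ x k) (^ₛ≡^ y (suc p ℕ.∸ k))))
  first : t zero ≡ y ^ suc p
  first = trans (term 0) (trans (ℤ.*-identityˡ _) (ℤ.*-identityˡ _))
  final : last (tail t) ≡ x ^ suc p
  final = begin
    last (tail t)                                       ≡⟨ term (suc (toℕ (fromℕ p))) ⟩
    + (suc p C k) * (x ^ k * y ^ (suc p ℕ.∸ k))         ≡⟨ cong (λ k → + (suc p C k) * (x ^ k * y ^ (suc p ℕ.∸ k)))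
                                                                (cong suc (toℕ-fromℕ p)) ⟩
    + (suc p C suc p) * (x ^ suc p * y ^ (p ℕ.∸ p))     ≡⟨ cong₂ (λ c e → + c * (x ^ suc p * y ^ e))
                                                                 (nCn≡1 (suc p)) (ℕ.n∸n≡0 p) ⟩
    + 1 * (x ^ suc p * 1ℤ)                              ≡⟨ trans (ℤ.*-identityˡ _) (ℤ.*-identityʳ _) ⟩
    x ^ suc p                                           ∎
    where
    k : ℕ
    k = suc (toℕ (fromℕ p))
  p∣inner : ∀ i → + suc p ∣ℤ init (tail t) i
  p∣inner i = subst (+ suc p ∣ℤ_) (sym (term k)) (ℤ∣.∣m⇒∣m*n (x ^ k * y ^ (suc p ℕ.∸ k)) p∣C)
    where
    k : ℕ
    k = suc (toℕ (inject₁ i))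
    p∣C : + suc p ∣ℤ + (suc p C k)
    p∣C = ℤ∣.∣ᵤ⇒∣ (prime∣C pp ℕ.z<s (ℕ.s<s (subst (ℕ._< p) (sym (toℕ-inject₁ i)) (toℕ<n i))))
  expansion : (x + y) ^ suc p ≡ t zero + (inner + last (tail t))
  expansion = trans (sym (^ₛ≡^ (x + y) (suc p))) (trans (theorem (suc p) x y) (cong (_+_ (t zero)) (sum-init-last (tail t))))
  cancel : ∀ m a b → m ≡ b + (m + a) - a - b
  cancel = solve-∀
  inner≡ : inner ≡ (x + y) ^ suc p - x ^ suc p - y ^ suc p
  inner≡ = begin
    inner
      ≡⟨ cancel inner (x ^ suc p) (y ^ suc p) ⟩
    y ^ suc p + (inner + x ^ suc p) - x ^ suc p - y ^ suc p
      ≡⟨ cong (λ s → s - x ^ suc p - y ^ suc p) (cong₂ (λ a b → a + (inner + b)) first final) ⟨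
    t zero + (inner + last (tail t)) - x ^ suc p - y ^ suc p
      ≡⟨ cong (λ s → s - x ^ suc p - y ^ suc p) expansion ⟨
    (x + y) ^ suc p - x ^ suc p - y ^ suc p
      ∎

fermat-ℕ : ∀ {p} → Prime p → ∀ n → + p ∣ℤ (+ n) ^ p - + n
fermat-ℕ {suc p} pp zero    = ℤ∣.divides 0ℤ refl
fermat-ℕ {suc p} pp (suc n) = subst (+ P ∣ℤ_) step (ℤ∣.∣m∣n⇒∣m+n (freshmansDream pp 1ℤ (+ n)) (fermat-ℕ pp n))
  where
  open ≡-Reasoning
  P : ℕ
  P = suc p
  telescope : ∀ a A B → (B - 1ℤ - A) + (A - a) ≡ B - (1ℤ + a)
  telescope = solve-∀
  step : (1ℤ + + n) ^ P - 1ℤ ^ P - (+ n) ^ P + ((+ n) ^ P - + n) ≡ (+ suc n) ^ P - + suc n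
  step = begin
    (1ℤ + + n) ^ P - 1ℤ ^ P - (+ n) ^ P + ((+ n) ^ P - + n)
      ≡⟨ cong (λ o → (1ℤ + + n) ^ P - o - (+ n) ^ P + ((+ n) ^ P - + n)) (ℤ.^-zeroˡ P) ⟩
    (1ℤ + + n) ^ P - 1ℤ - (+ n) ^ P + ((+ n) ^ P - + n)
      ≡⟨ telescope (+ n) ((+ n) ^ P) ((1ℤ + + n) ^ P) ⟩
    (1ℤ + + n) ^ P - (1ℤ + + n)
      ≡⟨ cong (λ a → a ^ P - a) (ℤ.pos-+ 1 n) ⟨
    (+ suc n) ^ P - + suc n
      ∎

fermat : ∀ {p} → Prime p → ∀ a → + p ∣ℤ a ^ p - a
fermat pp (+ n) = fermat-ℕ pp n
fermat {suc p} pp -[1+ n ] =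
  subst (+ P ∣ℤ_) (sym (reflect a (a ^ P) (b ^ P)))
    (ℤ∣.∣m∣n⇒∣m-n (ℤ∣.∣m⇒∣-m p∣-[a^p+b^p]) (fermat-ℕ pp (suc n)))
  where
  P : ℕ
  P = suc p
  b a : ℤ
  b = + suc n
  a = - b
  -- (a + b)^p = 0 makes a^p ≡ −b^p mod p
  p∣-[a^p+b^p] : + P ∣ℤ 0ℤ - a ^ P - b ^ P
  p∣-[a^p+b^p] = subst (λ z → + P ∣ℤ z ^ P - a ^ P - b ^ P) (ℤ.+-inverseˡ b) (freshmansDream pp a b)
  reflect : ∀ a A B → A - a ≡ - (0ℤ - A - B) - (B - - a)
  reflect = solve-∀

geomSum : ℤ → ℤ → ℕ → ℤ
geomSum x y zero    = 0ℤ
geomSum x y (suc n) = x ^ n + y * geomSum x y n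

geomSum-diff : ∀ x y n → (x - y) * geomSum x y n ≡ x ^ n - y ^ n
geomSum-diff x y zero    = ℤ.*-zeroʳ (x - y)
geomSum-diff x y (suc n) = begin
  (x - y) * (x ^ n + y * geomSum x y n)           ≡⟨ expand (x - y) (x ^ n) y (geomSum x y n) ⟩
  (x - y) * x ^ n + y * ((x - y) * geomSum x y n) ≡⟨ cong (λ g → (x - y) * x ^ n + y * g) (geomSum-diff x y n) ⟩
  (x - y) * x ^ n + y * (x ^ n - y ^ n)           ≡⟨ collect x y (x ^ n) (y ^ n) ⟩
  x * x ^ n - y * y ^ n                           ∎
  where
  open ≡-Reasoning
  expand : ∀ d a y g → d * (a + y * g) ≡ d * a + y * (d * g)
  expand = solve-∀
  collect : ∀ x y a b → (x - y) * a + y * (a - b) ≡ x * a - y * b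
  collect = solve-∀

geomSum-+ : ∀ x y m n → geomSum x y (m ℕ.+ n) ≡ x ^ m * geomSum x y n + y ^ n * geomSum x y m
geomSum-+ x y m zero = begin
  geomSum x y (m ℕ.+ 0)           ≡⟨ cong (geomSum x y) (ℕ.+-identityʳ m) ⟩
  geomSum x y m                   ≡⟨ pad (x ^ m) (geomSum x y m) ⟩
  x ^ m * 0ℤ + 1ℤ * geomSum x y m ∎
  where
  open ≡-Reasoning
  pad : ∀ a g → g ≡ a * 0ℤ + 1ℤ * g
  pad = solve-∀
geomSum-+ x y m (suc n) = begin
  geomSum x y (m ℕ.+ suc n)
    ≡⟨ cong (geomSum x y) (ℕ.+-suc m n) ⟩
  x ^ (m ℕ.+ n) + y * geomSum x y (m ℕ.+ n)
    ≡⟨ cong₂ (λ a g → a + y * g) (ℤ.^-distribˡ-+-* x m n) (geomSum-+ x y m n) ⟩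
  x ^ m * x ^ n + y * (x ^ m * geomSum x y n + y ^ n * geomSum x y m)
    ≡⟨ regroup y (x ^ m) (x ^ n) (geomSum x y m) (geomSum x y n) (y ^ n) ⟩
  x ^ m * (x ^ n + y * geomSum x y n) + (y * y ^ n) * geomSum x y m
    ∎
  where
  open ≡-Reasoning
  regroup : ∀ y xm xn gm gn yn → xm * xn + y * (xm * gn + yn * gm) ≡ xm * (xn + y * gn) + (y * yn) * gm
  regroup = solve-∀

geomSum-* : ∀ x y m n → geomSum x y (m ℕ.* n) ≡ geomSum x y m * geomSum (x ^ m) (y ^ m) n
geomSum-* x y m zero    = trans (cong (geomSum x y) (ℕ.*-zeroʳ m)) (sym (ℤ.*-zeroʳ (geomSum x y m)))
geomSum-* x y m (suc n) = begin
  geomSum x y (m ℕ.* suc n)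
    ≡⟨ cong (geomSum x y) (trans (ℕ.*-suc m n) (ℕ.+-comm m (m ℕ.* n))) ⟩
  geomSum x y (m ℕ.* n ℕ.+ m)
    ≡⟨ geomSum-+ x y (m ℕ.* n) m ⟩
  x ^ (m ℕ.* n) * G + y ^ m * geomSum x y (m ℕ.* n)
    ≡⟨ cong₂ (λ a g → a * G + y ^ m * g) (ℤ.^-*-assoc x m n) (sym (geomSum-* x y m n)) ⟨
  (x ^ m) ^ n * G + y ^ m * (G * G′)
    ≡⟨ factor ((x ^ m) ^ n) (y ^ m) G G′ ⟩
  G * ((x ^ m) ^ n + y ^ m * G′)
    ∎
  where
  open ≡-Reasoning
  G G′ : ℤ
  G  = geomSum x y m
  G′ = geomSum (x ^ m) (y ^ m) n
  factor : ∀ a b g g′ → a * g + b * (g * g′) ≡ g * (a + b * g′)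
  factor = solve-∀

^-diff-∣ : ∀ {m} x y n → m ∣ℤ x - y → m ∣ℤ x ^ n - y ^ n
^-diff-∣ x y n m∣x-y = subst (_ ∣ℤ_) (geomSum-diff x y n) (ℤ∣.∣m⇒∣m*n (geomSum x y n) m∣x-y)

∣geomSum-[n+1]x^n : ∀ {m} x y n → m ∣ℤ x - y → m ∣ℤ geomSum x y (suc n) - + suc n * x ^ n
∣geomSum-[n+1]x^n x y zero    _      = subst (_ ∣ℤ_) (vanish y) (ℤ∣.divides 0ℤ refl)
  where
  vanish : ∀ y → 0ℤ ≡ 1ℤ + y * 0ℤ - + 1 * 1ℤ
  vanish = solve-∀
∣geomSum-[n+1]x^n x y (suc n) m∣x-y = subst (_ ∣ℤ_) (sym step)
  (ℤ∣.∣m∣n⇒∣m+n (ℤ∣.∣n⇒∣m*n y (∣geomSum-[n+1]x^n x y n m∣x-y))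
                (ℤ∣.∣n⇒∣m*n (+ suc n * x ^ n) (ℤ∣.∣m⇒∣-m m∣x-y)))
  where
  regroup : ∀ x y a g N → x * a + y * g - (1ℤ + N) * (x * a) ≡ y * (g - N * a) + N * a * - (x - y)
  regroup = solve-∀
  step : geomSum x y (suc (suc n)) - + suc (suc n) * x ^ suc n
       ≡ y * (geomSum x y (suc n) - + suc n * x ^ n) + + suc n * x ^ n * - (x - y)
  step = trans (cong (λ N → geomSum x y (suc (suc n)) - N * x ^ suc n) (ℤ.pos-+ 1 (suc n)))
               (regroup x y (x ^ n) (geomSum x y (suc n)) (+ suc n))

n∣geomSum : ∀ {x y} n → + n ∣ℤ x - y → + n ∣ℤ geomSum x y n
n∣geomSum         zero    _     = ℤ∣.divides 0ℤ refl
n∣geomSum {x} {y} (suc n) n∣x-y = subst (_ ∣ℤ_) (restore (geomSum x y (suc n)) (+ suc n * x ^ n))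
  (ℤ∣.∣m∣n⇒∣m+n (∣geomSum-[n+1]x^n x y n n∣x-y) (ℤ∣.∣m⇒∣m*n (x ^ n) ℤ∣.∣-refl))
  where
  restore : ∀ a b → a - b + b ≡ a
  restore = solve-∀

p^j∣geomSum : ∀ {p x y} j n → + p ∣ℤ x - y → p ℕ.^ j ∣ n → + (p ℕ.^ j) ∣ℤ geomSum x y n
p^j∣geomSum {x = x} {y} zero n _ _ = ℤ∣.divides (geomSum x y n) (sym (ℤ.*-identityʳ (geomSum x y n)))
p^j∣geomSum {p} {x} {y} (suc j) n p∣x-y (divides q refl) = subst₂ _∣ℤ_ (pos-^-suc p j) (sym G≡)
  (*-pres-∣ℤ (p^j∣geomSum j r p∣x-y (n∣m*n q)) (n∣geomSum p (^-diff-∣ x y r p∣x-y)))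
  where
  r : ℕ
  r = q ℕ.* p ℕ.^ j
  G≡ : geomSum x y (q ℕ.* p ℕ.^ suc j) ≡ geomSum x y r * geomSum (x ^ r) (y ^ r) p
  G≡ = trans (cong (geomSum x y) (x∙yz≈xz∙y q p (p ℕ.^ j))) (geomSum-* x y r p)

^p-lift : ∀ {p t x y} → + (p ℕ.^ suc t) ∣ℤ x - y → + (p ℕ.^ suc (suc t)) ∣ℤ x ^ p - y ^ p
^p-lift {p} {t} {x} {y} p^t+1∣x-y = subst₂ _∣ℤ_ (pos-^-suc p (suc t)) (geomSum-diff x y p)
  (*-pres-∣ℤ p^t+1∣x-y (n∣geomSum p (ℤ∣.∣-trans p∣p^t+1 p^t+1∣x-y)))
  where
  p∣p^t+1 : + p ∣ℤ + (p ℕ.^ suc t)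
  p∣p^t+1 = ℤ∣.∣ᵤ⇒∣ (m∣m*n (p ℕ.^ t))

pow-congruence : ∀ {p} → Prime p → ∀ a j m → p ℕ.^ j ∣ m → + (p ℕ.^ suc j) ∣ℤ a ^ (p ℕ.* m) - a ^ m
pow-congruence {p} pp a zero m _ =
  subst₂ _∣ℤ_ (cong +_ (sym (ℕ.*-identityʳ p))) (cong (_- a ^ m) (^-^ a m p)) (fermat pp (a ^ m))
pow-congruence {p} pp a (suc j) _ (divides q refl) =
  subst (λ m → + (p ℕ.^ suc (suc j)) ∣ℤ a ^ (p ℕ.* m) - a ^ m) (sym m≡p*m′)
    (subst (+ (p ℕ.^ suc (suc j)) ∣ℤ_) (cong₂ _-_ (^-^ a (p ℕ.* m′) p) (^-^ a m′ p))
      (^p-lift {p} {j} (pow-congruence pp a j m′ (n∣m*n q))))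
  where
  m′ : ℕ
  m′ = q ℕ.* p ℕ.^ j
  m≡p*m′ : q ℕ.* p ℕ.^ suc j ≡ p ℕ.* m′
  m≡p*m′ = x∙yz≈y∙xz q p (p ℕ.^ j)

pow-gauss : ∀ {p} → Prime p → ∀ a → GaussAt p (a ^_)
pow-gauss pp a .congruence = pow-congruence pp a

geomSum-gauss : ∀ {p x y} → + p ∣ℤ x - y → GaussAt p (λ n → + p * geomSum x y n)
geomSum-gauss {p} {x} {y} p∣x-y .congruence j m p^j∣m = subst₂ _∣ℤ_ (sym (ℤ.pos-* p (p ℕ.^ j))) (factor (+ p) _ _)
  (ℤ∣.*-monoʳ-∣ (+ p) (ℤ∣.∣m∣n⇒∣m-n (p^j∣geomSum j (p ℕ.* m) p∣x-y (∣n⇒∣m*n p p^j∣m))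
                                    (p^j∣geomSum j m p∣x-y p^j∣m)))
  where
  factor : ∀ c a b → c * (a - b) ≡ c * a - c * b
  factor = solve-∀

-- Binary recurrences

binet : ∀ {r₁ r₂ α β} (U : ℕ → ℤ) → (∀ n → U (suc (suc n)) ≡ r₁ * U (suc n) + r₂ * U n) →
        r₁ ≡ α + β → r₂ ≡ - (α * β) → ∀ n → U n ≡ (U 1 - β * U 0) * geomSum α β n + U 0 * β ^ n
binet {β = β} U rec refl refl zero = initial (U 1 - β * U 0) (U 0)
  where
  initial : ∀ c u → u ≡ c * 0ℤ + u * 1ℤ
  initial = solve-∀
binet {β = β} U rec refl refl (suc zero) = initial (U 1) (U 0) β
  where
  initial : ∀ u₁ u₀ b → u₁ ≡ (u₁ - b * u₀) * (1ℤ + b * 0ℤ) + u₀ * (b * 1ℤ)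
  initial = solve-∀
binet {α = α} {β} U rec refl refl (suc (suc n)) = begin
  U (suc (suc n))
    ≡⟨ rec n ⟩
  (α + β) * U (suc n) + - (α * β) * U n
    ≡⟨ cong₂ (λ u u′ → (α + β) * u + - (α * β) * u′) (binet U rec refl refl (suc n)) (binet U rec refl refl n) ⟩
  (α + β) * (c * geomSum α β (suc n) + U 0 * β ^ suc n) + - (α * β) * (c * geomSum α β n + U 0 * β ^ n)
    ≡⟨ step α β c (U 0) (α ^ n) (β ^ n) (geomSum α β n) ⟩
  c * geomSum α β (suc (suc n)) + U 0 * β ^ suc (suc n)
    ∎
  where
  open ≡-Reasoning
  c : ℤ
  c = U 1 - β * U 0
  step : ∀ α β c u a b g → (α + β) * (c * (a + β * g) + u * (β * b)) + - (α * β) * (c * g + u * b)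
                         ≡ c * (α * a + β * (a + β * g)) + u * (β * (β * b))
  step = solve-∀

discriminant-parity : ∀ r₁ r₂ k → r₁ ^ 2 + + 4 * r₂ ≡ k * k → + 2 ∣ℤ k + r₁
discriminant-parity r₁ r₂ k Δ≡k² with (k + r₁) ℤ.% + 2 | ℤ.n%d<d (k + r₁) (+ 2) | ℤ.a≡a%n+[a/n]*n (k + r₁) (+ 2)
... | 0           | _                  | k+r₁≡2t   = ℤ∣.divides ((k + r₁) ℤ./ + 2) (trans k+r₁≡2t (ℤ.+-identityˡ _))
... | 1           | _                  | k+r₁≡2t+1 = ⊥-elim (2∤1 (ℤ∣.∣⇒∣ᵤ (ℤ∣.divides w 1≡2w)))
  where
  open ≡-Reasoning
  t w : ℤ
  t = (k + r₁) ℤ./ + 2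
  w = + 2 * r₂ - + 2 * t * t - + 2 * t + r₁ * (+ 2 * t + 1ℤ)
  2∤1 : ¬ 2 ∣ 1
  2∤1 2∣1 with ∣1⇒≡1 2∣1
  ... | ()
  shift : ∀ k r → k ≡ (k + r) - r
  shift = solve-∀
  cancel : ∀ a → 1ℤ ≡ a - a + 1ℤ
  cancel = solve-∀
  odd : ∀ r₁ r₂ t → r₁ * (r₁ * 1ℤ) + + 4 * r₂ - (+ 1 + t * + 2 - r₁) * (+ 1 + t * + 2 - r₁) + 1ℤ
                  ≡ (+ 2 * r₂ - + 2 * t * t - + 2 * t + r₁ * (+ 2 * t + 1ℤ)) * + 2
  odd = solve-∀
  1≡2w : 1ℤ ≡ w * + 2
  1≡2w = begin
    1ℤ
      ≡⟨ cancel (k * k) ⟩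
    k * k - k * k + 1ℤ
      ≡⟨ cong (λ d → d - k * k + 1ℤ) Δ≡k² ⟨
    r₁ ^ 2 + + 4 * r₂ - k * k + 1ℤ
      ≡⟨ cong (λ k → r₁ ^ 2 + + 4 * r₂ - k * k + 1ℤ) (trans (shift k r₁) (cong (_- r₁) k+r₁≡2t+1)) ⟩
    r₁ ^ 2 + + 4 * r₂ - (+ 1 + t * + 2 - r₁) * (+ 1 + t * + 2 - r₁) + 1ℤ
      ≡⟨ odd r₁ r₂ t ⟩
    w * + 2
      ∎
... | suc (suc _) | ℕ.s≤s (ℕ.s≤s ()) | _

integerRoots : ∀ r₁ r₂ k → r₁ ^ 2 + + 4 * r₂ ≡ k * k →
               ∃₂ λ α β → r₁ ≡ α + β × r₂ ≡ - (α * β) × α - β ≡ k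
integerRoots r₁ r₂ k Δ≡k² with discriminant-parity r₁ r₂ k Δ≡k²
... | ℤ∣.divides t k+r₁≡2t = t , r₁ - t , split r₁ t , ℤ.*-cancelˡ-≡ (+ 4) r₂ (- (t * (r₁ - t))) 4r₂≡ , sym k≡
  where
  open ≡-Reasoning
  split : ∀ r t → r ≡ t + (r - t)
  split = solve-∀
  shift : ∀ k r → k ≡ (k + r) - r
  shift = solve-∀
  double : ∀ t r → t * + 2 - r ≡ t - (r - t)
  double = solve-∀
  isolate : ∀ r₁ r₂ → + 4 * r₂ ≡ r₁ * (r₁ * 1ℤ) + + 4 * r₂ - r₁ * (r₁ * 1ℤ)
  isolate = solve-∀
  expand : ∀ r₁ t → (t - (r₁ - t)) * (t - (r₁ - t)) - r₁ * (r₁ * 1ℤ) ≡ + 4 * - (t * (r₁ - t))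
  expand = solve-∀
  k≡ : k ≡ t - (r₁ - t)
  k≡ = trans (shift k r₁) (trans (cong (_- r₁) k+r₁≡2t) (double t r₁))
  4r₂≡ : + 4 * r₂ ≡ + 4 * - (t * (r₁ - t))
  4r₂≡ = begin
    + 4 * r₂                                 ≡⟨ isolate r₁ r₂ ⟩
    r₁ ^ 2 + + 4 * r₂ - r₁ ^ 2               ≡⟨ cong (_- r₁ ^ 2) Δ≡k² ⟩
    k * k - r₁ ^ 2                           ≡⟨ cong (λ k → k * k - r₁ ^ 2) k≡ ⟩
    (t - (r₁ - t)) * (t - (r₁ - t)) - r₁ ^ 2 ≡⟨ expand r₁ t ⟩
    + 4 * - (t * (r₁ - t))                   ∎

binaryRecurrence-gauss : ∀ {p α β c d} R → Prime p → (p ∣ ℤ.∣ α - β ∣ → p ∣ R) →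
                         GaussAt p (λ n → + R * (c * geomSum α β n + d * β ^ n))
binaryRecurrence-gauss {p} {α} {β} {c} {d} R pp p∣α-β⇒p∣R with p ∣? ℤ.∣ α - β ∣
... | no p∤α-β = GaussAt-*ˡ (+ R) (GaussAt-cancel (α - β) pp p∤α-β (GaussAt-cong regroup
  (GaussAt-+ (GaussAt-*ˡ c (pow-gauss pp α)) (GaussAt-*ˡ ((α - β) * d - c) (pow-gauss pp β)))))
  where
  open ≡-Reasoning
  split : ∀ k c d a b → c * a + (k * d - c) * b ≡ c * (a - b) + k * d * b
  split = solve-∀
  merge : ∀ k c d g b → c * (k * g) + k * d * b ≡ k * (c * g + d * b)
  merge = solve-∀
  regroup : ∀ n → c * α ^ n + ((α - β) * d - c) * β ^ n ≡ (α - β) * (c * geomSum α β n + d * β ^ n)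
  regroup n = begin
    c * α ^ n + ((α - β) * d - c) * β ^ n               ≡⟨ split (α - β) c d (α ^ n) (β ^ n) ⟩
    c * (α ^ n - β ^ n) + (α - β) * d * β ^ n
      ≡⟨ cong (λ x → c * x + (α - β) * d * β ^ n) (geomSum-diff α β n) ⟨
    c * ((α - β) * geomSum α β n) + (α - β) * d * β ^ n ≡⟨ merge (α - β) c d (geomSum α β n) (β ^ n) ⟩
    (α - β) * (c * geomSum α β n + d * β ^ n)           ∎
... | yes p∣α-β with p∣α-β⇒p∣R p∣α-β
...   | divides R′ refl = GaussAt-cong regroup
  (GaussAt-+ (GaussAt-*ˡ (+ R′ * c) (geomSum-gauss (ℤ∣.∣ᵤ⇒∣ p∣α-β)))
             (GaussAt-*ˡ (+ (R′ ℕ.* p) * d) (pow-gauss pp β)))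
  where
  distrib : ∀ r p c d g b → r * c * (p * g) + r * p * d * b ≡ r * p * (c * g + d * b)
  distrib = solve-∀
  regroup : ∀ n → + R′ * c * (+ p * geomSum α β n) + + (R′ ℕ.* p) * d * β ^ n
                ≡ + (R′ ℕ.* p) * (c * geomSum α β n + d * β ^ n)
  regroup n = begin
    + R′ * c * (+ p * geomSum α β n) + + (R′ ℕ.* p) * d * β ^ n
      ≡⟨ cong (λ r → + R′ * c * (+ p * geomSum α β n) + r * d * β ^ n) (ℤ.pos-* R′ p) ⟩
    + R′ * c * (+ p * geomSum α β n) + + R′ * + p * d * β ^ n
      ≡⟨ distrib (+ R′) (+ p) c d (geomSum α β n) (β ^ n) ⟩
    + R′ * + p * (c * geomSum α β n + d * β ^ n)
      ≡⟨ cong (λ r → r * (c * geomSum α β n + d * β ^ n)) (ℤ.pos-* R′ p) ⟨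
    + (R′ ℕ.* p) * (c * geomSum α β n + d * β ^ n)
      ∎
    where open ≡-Reasoning

binaryRecurrence-dold : ∀ {r₁ r₂ α β} (U : ℕ → ℤ) → (∀ n → U (suc (suc n)) ≡ r₁ * U (suc n) + r₂ * U n) →
  r₁ ≡ α + β → r₂ ≡ - (α * β) → ∀ R → (∀ {p} → Prime p → p ∣ ℤ.∣ α - β ∣ → p ∣ R) →
  Dold (λ n → r₂ * + R * U n)
binaryRecurrence-dold {r₁} {r₂} {α} {β} U rec r₁≡α+β r₂≡-αβ R p∣α-β⇒p∣R =
  gauss⇒dold {λ n → r₂ * + R * U n} λ p pp →
    GaussAt-cong rearrange (GaussAt-*ˡ r₂ (binaryRecurrence-gauss {α = α} {β} {c} {U 0} R pp (p∣α-β⇒p∣R pp)))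
  where
  c : ℤ
  c = U 1 - β * U 0
  rearrange : ∀ n → r₂ * (+ R * (c * geomSum α β n + U 0 * β ^ n)) ≡ r₂ * + R * U n
  rearrange n = trans (cong (λ u → r₂ * (+ R * u)) (sym (binet U rec r₁≡α+β r₂≡-αβ n)))
                      (sym (ℤ.*-assoc r₂ (+ R) (U n)))

theorem2 : (r₁ r₂ : ℤ) (U : ℕ → ℤ) →
    (∀ n → U (suc (suc n)) ≡ r₁ * U (suc n) + r₂ * U n) →
    (r₁ ^ 2 + (+ 4) * r₂) ≢ 0ℤ →
    ∃ (λ (k : ℤ) → r₁ ^ 2 + (+ 4) * r₂ ≡ k * k) →
    Dold (λ n → r₂ * (+ rad (r₁ ^ 2 + (+ 4) * r₂)) * U n)
theorem2 r₁ r₂ U rec Δ≢0 (k , Δ≡k²) = fromRoots (integerRoots r₁ r₂ k Δ≡k²)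
  where
  Δ : ℤ
  Δ = r₁ ^ 2 + + 4 * r₂
  instance
    ∣Δ∣≢0 : NonZero ℤ.∣ Δ ∣
    ∣Δ∣≢0 = ℕ.≢-nonZero (Δ≢0 ∘ ℤ.∣i∣≡0⇒i≡0)
  ∣k∣∣∣Δ∣ : ℤ.∣ k ∣ ∣ ℤ.∣ Δ ∣
  ∣k∣∣∣Δ∣ = subst (ℤ.∣ k ∣ ∣_) (trans (sym (ℤ.abs-* k k)) (cong ℤ.∣_∣ (sym Δ≡k²))) (m∣m*n ℤ.∣ k ∣)
  fromRoots : (∃₂ λ α β → r₁ ≡ α + β × r₂ ≡ - (α * β) × α - β ≡ k) → Dold (λ n → r₂ * + rad Δ * U n)
  fromRoots (α , β , r₁≡α+β , r₂≡-αβ , α-β≡k) =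
    binaryRecurrence-dold {α = α} {β} U rec r₁≡α+β r₂≡-αβ (rad Δ)
      (λ pp p∣α-β → ∣⇒∣rad {Δ} pp (∣-trans (subst (λ x → _ ∣ ℤ.∣ x ∣) α-β≡k p∣α-β) ∣k∣∣∣Δ∣))
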